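{- Let $S\in\{0,1\}^n$ and define $\delta(0)=\texttt{()}$ and $\delta(1)=\texttt{((}$, and $\Delta(S)=\texttt{(}\cdot\delta(S[1])\cdots\delta(S[n])\cdot\texttt{)}^{k+1}$ where $k=2\cdot S.rank_1(n)$. If $S$ has a Straight-Line Program of size $g$, then $\Delta(S)$ has a Straight-Line Program of size $O(g+\log n)$.
   Context: A Straight-Line Program (SLP) is a context-free grammar generating exactly one string, with rules of the form $X\to AB$ ($A,B$ terminals or nonterminals); its size is the number of nonterminals. $S.rank_1(i)$ is the number of 1s in $S[1..i]$. -}

module Defs where

open import Data.Nat using (ℕ; zero; suc; _+_; _*_)
open import Data.Fin using (Fin; zero; suc)
open import Data.Bool using (Bool; true; false)
open import Data.List using (List; []; _∷_; _++_; concatMap; replicate)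
open import Data.Vec using (Vec; toList; count)
open import Data.Product using (Σ; ∃-syntax; _×_)
open import Relation.Binary.PropositionalEquality using (_≡_)
open import Relation.Nullary.Decidable using (yes; no)
open import Data.Bool.Properties using (T?)
open import Data.Bool using (T)

-- Inside  G ▷ r , the nonterminal  zero  is the newest one
-- (defined by rule r) and  suc j  refers to nonterminal j of G.
-- The start symbol is the newest (last defined) nonterminal.

data Sym (A : Set) (n : ℕ) : Set where
  term : A → Sym A n
  nt   : Fin n → Sym A n

data SLP (A : Set) : ℕ → Set where
  []  : SLP A zero
  _▷_ : {n : ℕ} → SLP A n → Sym A n × Sym A n → SLP A (suc n)

open import Data.Product using (_,_)

mutual
  expandNT : {A : Set} {n : ℕ} → SLP A n → Fin n → List A
  expandNT (G ▷ (x , y)) zero    = expandSym G x ++ expandSym G y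
  expandNT (G ▷ r)       (suc j) = expandNT G j

  expandSym : {A : Set} {n : ℕ} → SLP A n → Sym A n → List A
  expandSym G (term a) = a ∷ []
  expandSym G (nt j)   = expandNT G j

-- w has an SLP of size g (g = number of nonterminals, start symbol
-- is the last rule, so g ≥ 1).
HasSLPOfSize : {A : Set} → List A → ℕ → Set
HasSLPOfSize {A} w g =
  ∃[ m ] (g ≡ suc m × Σ (SLP A (suc m)) (λ G → expandNT G zero ≡ w))

data Paren : Set where
  op cl : Paren

δ : Bool → List Paren
δ false = op ∷ cl ∷ []
δ true  = op ∷ op ∷ []

rank1 : {n : ℕ} → Vec Bool n → ℕ
rank1 = count T?

Δ : {n : ℕ} → Vec Bool n → List Paren
Δ S = op ∷ (concatMap δ (toList S) ++ replicate (2 * rank1 S + 1) cl)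

{-# OPTIONS --safe #-}
module Submission where

-- Δ(S) = ( · h₁(S) · h₂(S) · ) for the two morphisms h₁ = δ and h₂ with
-- h₂(0) = ε, h₂(1) = )), since h₂(S) consists of exactly 2·rank₁(S) closing
-- parentheses.  The image of an SLP under a morphism is obtained by replacing
-- each terminal with a symbol for its image, one new rule per old rule (a rule
-- whose side has an empty image is dropped).  Two such images, a grammar for
-- the images of the letters, one concatenation and the outer parentheses give
-- an SLP of size 2g + 6.

open import Defs
open import Data.Nat using (ℕ; zero; suc; _+_; _*_; _≤_)
open import Data.Nat.Properties
open import Data.Nat.Logarithm using (⌈log₂_⌉)
open import Data.Nat.Tactic.RingSolver using (solve)
open import Data.Bool using (Bool; true; false)
open import Data.Fin using (zero; suc)
open import Data.Maybe using (Maybe; just; nothing)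
open import Data.List as List using (List; []; _∷_; _++_; concatMap; replicate)
open import Data.List.Properties using (++-identityʳ; ++-assoc; concatMap-++)
open import Data.Vec using (Vec; toList; []; _∷_)
open import Data.Product using (Σ; ∃-syntax; _×_; _,_; proj₁; proj₂)
open import Relation.Binary.PropositionalEquality

private
  variable
    A B : Set
    m k d : ℕ

record Extension (H : SLP B m) (d : ℕ) : Set where
  field
    size        : ℕ
    grammar     : SLP B size
    size≤       : size ≤ d + m
    lift        : Sym B m → Sym B size
    expand-lift : ∀ s → expandSym grammar (lift s) ≡ expandSym H s

open Extension

noRules : {H : SLP B m} {d : ℕ} → Extension H d
noRules {m = m} {H = H} {d = d} = record
  { size = m ; grammar = H ; size≤ = m≤n+m m d ; lift = λ s → s ; expand-lift = λ _ → refl }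

addRule : (H : SLP B m) (r : Sym B m × Sym B m) → Extension H 1
addRule {m = m} H r = record
  { size = suc m ; grammar = H ▷ r ; size≤ = ≤-refl ; lift = weaken ; expand-lift = expand-weaken }
  where
  weaken : Sym B m → Sym B (suc m)
  weaken (term a) = term a
  weaken (nt j)   = nt (suc j)

  expand-weaken : ∀ s → expandSym (H ▷ r) (weaken s) ≡ expandSym H s
  expand-weaken (term a) = refl
  expand-weaken (nt j)   = refl

_then_ : {H : SLP B m} {d₁ d₂ : ℕ} (E : Extension H d₁) → Extension (grammar E) d₂ → Extension H (d₂ + d₁)
_then_ {m = m} {d₁ = d₁} {d₂ = d₂} E F = record
  { size        = size F
  ; grammar     = grammar F
  ; size≤       = ≤-trans (size≤ F) (≤-trans (+-monoʳ-≤ d₂ (size≤ E)) (≤-reflexive (sym (+-assoc d₂ d₁ m))))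
  ; lift        = λ s → lift F (lift E s)
  ; expand-lift = λ s → trans (expand-lift F (lift E s)) (expand-lift E s)
  }

-- Symbols are optional so that the empty word, which has no symbol, can be generated.
expandOpt : SLP B m → Maybe (Sym B m) → List B
expandOpt H nothing  = []
expandOpt H (just s) = expandSym H s

Generates : SLP B m → List B → Set
Generates {B = B} {m = m} H w = Σ (Maybe (Sym B m)) λ s → expandOpt H s ≡ w

Generates-lift : {H : SLP B m} {w : List B} (E : Extension H d) → Generates H w → Generates (grammar E) w
Generates-lift E (nothing , e) = nothing , e
Generates-lift E (just s , e)  = just (lift E s) , trans (expand-lift E s) e

Generates-++ : {H : SLP B m} {u v : List B} → Generates H u → Generates H v →
               Σ (Extension H 1) λ E → Generates (grammar E) (u ++ v)
Generates-++ (nothing , refl) (t , refl)       = noRules , t , refl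
Generates-++ (just s , refl) (nothing , refl)  = noRules , just s , sym (++-identityʳ _)
Generates-++ {H = H} (just s , refl) (just t , refl) = addRule H (s , t) , just (nt zero) , refl

image : (h : A → List B) (G : SLP A k) {H : SLP B m} → (∀ a → Generates H (h a)) →
        Σ (Extension H k) λ E → ∀ j → Generates (grammar E) (concatMap h (expandNT G j))
image h []            base = noRules , λ ()
image h (G ▷ (x , y)) base with image h G base
... | E , old = E then F , images
  where
  imageSym : ∀ s → Generates (grammar E) (concatMap h (expandSym G s))
  imageSym (term a) = subst (Generates (grammar E)) (sym (++-identityʳ (h a))) (Generates-lift E (base a))
  imageSym (nt j)   = old j

  joined : Σ (Extension (grammar E) 1) λ F →
             Generates (grammar F) (concatMap h (expandSym G x) ++ concatMap h (expandSym G y))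
  joined = Generates-++ (imageSym x) (imageSym y)
  F : Extension (grammar E) 1
  F = proj₁ joined

  images : ∀ j → Generates (grammar F) (concatMap h (expandNT (G ▷ (x , y)) j))
  images zero    = subst (Generates _) (sym (concatMap-++ h (expandSym G x) (expandSym G y))) (proj₂ joined)
  images (suc j) = Generates-lift F (old j)

wrap : {H : SLP B m} {w : List B} → Generates H w → (a c : B) →
       ∃[ g ] (HasSLPOfSize (a ∷ w ++ c ∷ []) g × g ≤ 2 + m)
wrap {m = m} {H = H} (nothing , refl) a c = suc m , (m , refl , H ▷ (term a , term c) , refl) , n≤1+n (suc m)
wrap {m = m} {H = H} (just s , refl)  a c =
  suc (suc m) , (suc m , refl , (H ▷ (term a , s)) ▷ (nt zero , term c) , refl) , ≤-refl

replicate-+ : ∀ m n (x : A) → replicate (m + n) x ≡ replicate m x ++ replicate n x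
replicate-+ zero    n x = refl
replicate-+ (suc m) n x = cong (x ∷_) (replicate-+ m n x)

closers : Bool → List Paren
closers false = []
closers true  = cl ∷ cl ∷ []

closers-count : ∀ {n} (S : Vec Bool n) → concatMap closers (toList S) ≡ replicate (2 * rank1 S) cl
closers-count []          = refl
closers-count (false ∷ S) = closers-count S
closers-count (true ∷ S)  = begin
  cl ∷ cl ∷ concatMap closers (toList S) ≡⟨ cong (λ w → cl ∷ cl ∷ w) (closers-count S) ⟩
  replicate (2 + 2 * rank1 S) cl        ≡⟨ cong (λ r → replicate r cl) (sym (*-suc 2 (rank1 S))) ⟩
  replicate (2 * suc (rank1 S)) cl      ∎
  where open ≡-Reasoning

Δ-images : ∀ {n} (S : Vec Bool n) →
           Δ S ≡ op ∷ (concatMap δ (toList S) ++ concatMap closers (toList S)) ++ cl ∷ []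
Δ-images S = cong (op ∷_) (begin
  P ++ replicate (2 * r + 1) cl                  ≡⟨ cong (P ++_) (replicate-+ (2 * r) 1 cl) ⟩
  P ++ (replicate (2 * r) cl ++ cl ∷ [])         ≡⟨ cong (λ C → P ++ (C ++ cl ∷ [])) (sym (closers-count S)) ⟩
  P ++ (concatMap closers (toList S) ++ cl ∷ [])  ≡⟨ sym (++-assoc P _ _) ⟩
  (P ++ concatMap closers (toList S)) ++ cl ∷ []  ∎)
  where
  open ≡-Reasoning

  P : List Paren
  P = concatMap δ (toList S)

  r : ℕ
  r = rank1 S

parens : SLP Paren 3
parens = (([] ▷ (term op , term cl)) ▷ (term op , term op)) ▷ (term cl , term cl)

δ-generated : ∀ b → Generates parens (δ b)
δ-generated false = just (nt (suc (suc zero))) , refl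
δ-generated true  = just (nt (suc zero)) , refl

closers-generated : ∀ b → Generates parens (closers b)
closers-generated false = nothing , refl
closers-generated true  = just (nt zero) , refl

images-slp : ∀ {w g} → HasSLPOfSize w g →
             ∃[ g′ ] (HasSLPOfSize (op ∷ (concatMap δ w ++ concatMap closers w) ++ cl ∷ []) g′ × g′ ≤ 2 * g + 6)
images-slp (m , refl , G , refl) with image δ G δ-generated
... | E₁ , opens with image closers G (λ b → Generates-lift E₁ (closers-generated b))
... | E₂ , closes with Generates-++ (Generates-lift E₂ (opens zero)) (closes zero)
... | E₃ , both with wrap both op cl
... | g′ , slp , g′≤ = g′ , slp , (begin
  g′                            ≤⟨ g′≤ ⟩
  2 + size E₃                   ≤⟨ +-monoʳ-≤ 2 (size≤ E₃) ⟩
  3 + size E₂                   ≤⟨ +-monoʳ-≤ 3 (size≤ E₂) ⟩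
  3 + (suc m + size E₁)         ≤⟨ +-monoʳ-≤ (4 + m) (size≤ E₁) ⟩
  3 + (suc m + (suc m + 3))     ≡⟨ solve (m List.∷ List.[]) ⟩
  2 * suc m + 6                 ∎)
  where open ≤-Reasoning

2[1+m]+6≤8[1+m] : ∀ m → 2 * suc m + 6 ≤ 8 * suc m
2[1+m]+6≤8[1+m] m = begin
  2 * suc m + 6  ≡⟨ solve (m List.∷ List.[]) ⟩
  8 + 2 * m      ≤⟨ +-monoʳ-≤ 8 (*-monoˡ-≤ m (m≤m+n 2 6)) ⟩
  8 + 8 * m      ≡⟨ sym (*-suc 8 m) ⟩
  8 * suc m      ∎
  where open ≤-Reasoning

lemma11 : ∃[ c ] ((n : ℕ) (S : Vec Bool n) (g : ℕ) → HasSLPOfSize (toList S) g →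
            ∃[ g′ ] (HasSLPOfSize (Δ S) g′ × g′ ≤ c * (g + ⌈log₂ n ⌉)))
lemma11 = 8 , λ where
  n S (suc m) slp@(_ , refl , _) → let g′ , slp′ , g′≤ = images-slp slp in
    g′ , subst (λ w → HasSLPOfSize w g′) (sym (Δ-images S)) slp′ ,
    ≤-trans g′≤ (≤-trans (2[1+m]+6≤8[1+m] m) (*-monoʳ-≤ 8 (m≤m+n (suc m) ⌈log₂ n ⌉)))
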